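{- A permutation $\sigma$ (viewed as a packed word in one-line notation) is blue-irreducible if and only if $\sigma^{ -1}$ is red-irreducible.
   Context: Words over positive integers; $|w|$ length, $\max(w)$ largest letter ($\max(\varepsilon)=0$), $w^{[k]}$ adds $k$ to every letter. Packed: all integers $1..\max(w)$ occur; a permutation of $\{1..n\}$ is a packed word of length $n$ with distinct letters. $u\odot v=u^{[\max(v)]}\cdot v$. A global descent of $w$ of length $n$ is $c$, $1\le c\le n-1$, with every letter of $w_1..w_c$ strictly greater than every letter of $w_{c+1}..w_n$; irreducible = nonempty without global descent. Red: for packed $w$ of length $n$, $p\ge1$, $I=\{i_1<\dots<i_p\}\subseteq\{1..n+p\}$, $\phi_I(w)$ has letter $\max(w)+1$ at positions of $I$ and the letters of $w$ in order elsewhere; nonempty packed $v$ is uniquely $\phi_I(v')$, and $u\triangleleft_R v=\phi_{I+|u|}(u\odot v')$. Blue: $\psi_{i^\circ}(w)$ ($1\le i\le\max(w)+1$) adds $1$ to letters $\ge i$ and appends $i$; $\psi_{i^\bullet}(w)=w\cdot i$ ($1\le i\le\max(w)$); nonempty packed $v$ is uniquely $\psi_{i^\alpha}(v')$, and $u\triangleleft_B v=\psi_{(i+\max(u))^\alpha}(v'\odot u)$. A packed word $w$ is red-irreducible (resp. blue-irreducible) if it is irreducible and $w=u\triangleleft_R v$ (resp. $w=u\triangleleft_B v$) with $u,v$ packed, $v\ne\varepsilon$, implies $u=\varepsilon$. -}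

module Defs where

open import Data.Nat using (ℕ; zero; suc; _+_; _≤_; _<_; _⊔_; _≤ᵇ_; _≡ᵇ_)
open import Data.Bool using (Bool; true; false; if_then_else_)
open import Data.List using (List; []; _∷_; _++_; [_]; length; map; foldr; take; drop; replicate; upTo; filter)
open import Data.List.Relation.Unary.All using (All)
open import Data.List.Relation.Unary.Unique.Propositional using (Unique)
open import Data.List.Membership.Propositional using (_∈_)
open import Data.Product using (Σ; _×_)
open import Relation.Nullary using (¬_)
open import Relation.Binary.PropositionalEquality using (_≡_; _≢_)

-- Words over positive integers are lists of naturals (positivity is part of Packed).
Word : Set
Word = List ℕ

maxW : Word → ℕ
maxW = foldr _⊔_ 0

shift : ℕ → Word → Word
shift k = map (k +_)

_⊙_ : Word → Word → Word
u ⊙ v = shift (maxW v) u ++ v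

Packed : Word → Set
Packed w = All (λ x → 1 ≤ x) w × (∀ k → 1 ≤ k → k ≤ maxW w → k ∈ w)

IsPermutation : Word → Set
IsPermutation w = Packed w × Unique w

IsGlobalDescent : Word → ℕ → Set
IsGlobalDescent w c =
  1 ≤ c × c < length w × All (λ a → All (λ b → b < a) (drop c w)) (take c w)

Irreducible : Word → Set
Irreducible w = w ≢ [] × ¬ (Σ ℕ λ c → IsGlobalDescent w c)

-- Red construction.
-- A subset I ⊆ {1..m} is encoded as a Bool mask of length m
-- (position j is in I iff the j-th entry is true).

countTrue : List Bool → ℕ
countTrue [] = 0
countTrue (true ∷ bs) = suc (countTrue bs)
countTrue (false ∷ bs) = countTrue bs

-- I is a subset of {1..n+p} with p = |I| ≥ 1, where n = |w|
ValidMask : Word → List Bool → Set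
ValidMask w I = 1 ≤ countTrue I × length I ≡ length w + countTrue I

phiAux : ℕ → List Bool → Word → Word
phiAux m [] ws = ws
phiAux m (true ∷ bs) ws = m ∷ phiAux m bs ws
phiAux m (false ∷ bs) [] = phiAux m bs []
phiAux m (false ∷ bs) (x ∷ ws) = x ∷ phiAux m bs ws

-- φ_I(w): letter max(w)+1 at the positions of I, letters of w in order elsewhere
φ : List Bool → Word → Word
φ I w = phiAux (suc (maxW w)) I w

shiftMask : ℕ → List Bool → List Bool
shiftMask k I = replicate k false ++ I

-- RedProd u v w  :⇔  w = u ◁_R v, where v = φ_I(v') is the (unique) decomposition
RedProd : Word → Word → Word → Set
RedProd u v w = Σ (List Bool) λ I → Σ Word λ v' →
  Packed v' × ValidMask v' I × v ≡ φ I v' × w ≡ φ (shiftMask (length u) I) (u ⊙ v')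

data Colour : Set where
  ∘ : Colour
  • : Colour

ValidIdx : Colour → ℕ → Word → Set
ValidIdx ∘ i w = 1 ≤ i × i ≤ suc (maxW w)
ValidIdx • i w = 1 ≤ i × i ≤ maxW w

ψ : Colour → ℕ → Word → Word
ψ ∘ i w = map (λ x → if i ≤ᵇ x then suc x else x) w ++ [ i ]
ψ • i w = w ++ [ i ]

-- BlueProd u v w  :⇔  w = u ◁_B v, where v = ψ_{i^α}(v') is the (unique) decomposition
BlueProd : Word → Word → Word → Set
BlueProd u v w = Σ Colour λ α → Σ ℕ λ i → Σ Word λ v' →
  Packed v' × ValidIdx α i v' × v ≡ ψ α i v' × w ≡ ψ α (i + maxW u) (v' ⊙ u)

RedIrreducible : Word → Set
RedIrreducible w = Irreducible w ×
  (∀ u v → Packed u → Packed v → v ≢ [] → RedProd u v w → u ≡ [])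

BlueIrreducible : Word → Set
BlueIrreducible w = Irreducible w ×
  (∀ u v → Packed u → Packed v → v ≢ [] → BlueProd u v w → u ≡ [])

-- 1-based position of the first occurrence of j in w (0 if absent)
positionOf : ℕ → Word → ℕ
positionOf j [] = 0
positionOf j (x ∷ xs) = if j ≡ᵇ x then 1 else suc (positionOf j xs)

inverse : Word → Word
inverse σ = map (λ j → positionOf j σ) (map suc (upTo (length σ)))

{-# OPTIONS --safe #-}
-- A red or blue product whose result is a permutation is rigid: the red mask is a singleton
-- {j + 1}, the blue colour is ∘, and both factors are permutations. Inversion exchanges the
-- two rigid products. For σ = ψ∘ (j + 1 + |u|) (a ⊙ u), the word σ⁻¹ lists the positions in σ
-- of 1, 2, …: the positions in u of 1 … |u| shifted past a, the positions in a of 1 … j, the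
-- last position, and the positions in a of j + 1, …; that is φ_{{j + 1} + |u|} (u⁻¹ ⊙ a⁻¹).
-- Moreover c is a global descent of σ⁻¹ exactly when |σ| − c is one of σ (a global descent
-- splits a permutation into its top and bottom values, and inversion swaps positions with
-- values), so irreducibility is preserved as well.
module Submission where

open import Defs
open import Data.Bool using (Bool; true; false; if_then_else_)
open import Data.Empty using (⊥-elim)
open import Data.List using (List; []; _∷_; _++_; [_]; length; map; take; drop; replicate; applyUpTo)
open import Data.List.Properties using (length-++; length-map; length-take; length-drop; length-replicate; take-[]; drop-[]; map-++; map-∘; map-upTo; map-id-local; map-cong-local; ++-assoc; ++-conicalʳ; take++drop≡id)
open import Data.List.Relation.Unary.All as All using ([])
open import Data.List.Relation.Unary.AllPairs using ([]; _∷_)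
open import Data.List.Relation.Unary.Any using (here; there)
open import Data.List.Relation.Unary.Unique.Propositional using (Unique)
import Data.List.Relation.Unary.Unique.Propositional.Properties as Unique
open import Data.List.Relation.Binary.Subset.Propositional using (_⊆_)
open import Data.List.Membership.Propositional using (_∈_; _∉_)
open import Data.List.Membership.Propositional.Properties using (∈-map⁺; ∈-map⁻; ∈-++⁺ˡ; ∈-++⁺ʳ; ∈-++⁻; ∈-∃++)
open import Data.Nat
open import Data.Nat.Properties
open import Data.Nat.Tactic.RingSolver using (solve-∀)
open import Data.Product using (Σ; _×_; _,_; proj₁; proj₂; ∃)
open import Data.Sum using (_⊎_; inj₁; inj₂)
open import Function.Bundles using (_⇔_; mk⇔)
open import Relation.Nullary using (yes; no)
open import Relation.Binary.PropositionalEquality hiding ([_])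

-- ψ ∘ l w unfolds to map (bump l) w ++ [ l ].
bump : ℕ → ℕ → ℕ
bump l x = if l ≤ᵇ x then suc x else x

bump-≥ : ∀ {l x} → l ≤ x → bump l x ≡ suc x
bump-≥ {l} {x} l≤x with l ≤ᵇ x | ≤⇒≤ᵇ l≤x
... | true | _ = refl

bump-< : ∀ {l x} → x < l → bump l x ≡ x
bump-< {l} {x} x<l with l ≤ᵇ x | ≤ᵇ⇒≤ l x
... | false | _ = refl
... | true | l≤x = ⊥-elim (<⇒≱ x<l (l≤x _))

bump-separates : ∀ {l x y} → l ≤ x → y < l → bump l x ≢ bump l y
bump-separates {x = x} l≤x y<l eq =
  <⇒≱ y<l (≤-trans l≤x (≤-trans (n≤1+n x) (≤-reflexive (trans (sym (bump-≥ l≤x)) (trans eq (bump-< y<l))))))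

bump-injective : ∀ l {x y} → bump l x ≡ bump l y → x ≡ y
bump-injective l {x} {y} eq with l ≤? x | l ≤? y
... | yes l≤x | yes l≤y = suc-injective (trans (sym (bump-≥ l≤x)) (trans eq (bump-≥ l≤y)))
... | no l≰x | no l≰y = trans (sym (bump-< (≰⇒> l≰x))) (trans eq (bump-< (≰⇒> l≰y)))
... | yes l≤x | no l≰y = ⊥-elim (bump-separates l≤x (≰⇒> l≰y) eq)
... | no l≰x | yes l≤y = ⊥-elim (bump-separates l≤y (≰⇒> l≰x) (sym eq))

bump≢ : ∀ l x → bump l x ≢ l
bump≢ l x eq with l ≤? x
... | yes l≤x = <⇒≢ (s≤s l≤x) (trans (sym eq) (bump-≥ l≤x))
... | no l≰x = <⇒≢ (≰⇒> l≰x) (trans (sym (bump-< (≰⇒> l≰x))) eq)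

n≤bump : ∀ l x → x ≤ bump l x
n≤bump l x with l ≤? x
... | yes l≤x = ≤-trans (n≤1+n x) (≤-reflexive (sym (bump-≥ l≤x)))
... | no l≰x = ≤-reflexive (sym (bump-< (≰⇒> l≰x)))

bump≤suc : ∀ l x → bump l x ≤ suc x
bump≤suc l x with l ≤? x
... | yes l≤x = ≤-reflexive (bump-≥ l≤x)
... | no l≰x = ≤-trans (≤-reflexive (bump-< (≰⇒> l≰x))) (n≤1+n x)

∈⇒≤maxW : ∀ {x xs} → x ∈ xs → x ≤ maxW xs
∈⇒≤maxW {x} {_ ∷ ys} (here refl) = m≤m⊔n x (maxW ys)
∈⇒≤maxW {_} {y ∷ _} (there x∈ys) = ≤-trans (∈⇒≤maxW x∈ys) (m≤n⊔m y _)

maxW-≤ : ∀ {m xs} → (∀ {x} → x ∈ xs → x ≤ m) → maxW xs ≤ m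
maxW-≤ {xs = []} _ = z≤n
maxW-≤ {xs = x ∷ xs} bound = ⊔-lub (bound (here refl)) (maxW-≤ (λ x∈xs → bound (there x∈xs)))

maxW-++ : ∀ xs ys → maxW (xs ++ ys) ≡ maxW xs ⊔ maxW ys
maxW-++ [] ys = refl
maxW-++ (x ∷ xs) ys = trans (cong (x ⊔_) (maxW-++ xs ys)) (sym (⊔-assoc x (maxW xs) (maxW ys)))

maxW-shift : ∀ m xs → maxW (shift m xs) ⊔ m ≡ m + maxW xs
maxW-shift m [] = trans (⊔-identityˡ m) (sym (+-identityʳ m))
maxW-shift m (x ∷ xs) = begin
    ((m + x) ⊔ maxW (shift m xs)) ⊔ m ≡⟨ ⊔-assoc (m + x) _ m ⟩
    (m + x) ⊔ (maxW (shift m xs) ⊔ m) ≡⟨ cong ((m + x) ⊔_) (maxW-shift m xs) ⟩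
    (m + x) ⊔ (m + maxW xs)           ≡⟨ sym (+-distribˡ-⊔ m x (maxW xs)) ⟩
    m + (x ⊔ maxW xs)                 ∎
  where open ≡-Reasoning

maxW-⊙ : ∀ u v → maxW (u ⊙ v) ≡ maxW v + maxW u
maxW-⊙ u v = trans (maxW-++ (shift (maxW v) u) v) (maxW-shift (maxW v) u)

Unique-++⁻ˡ : ∀ xs {ys : List ℕ} → Unique (xs ++ ys) → Unique xs
Unique-++⁻ˡ [] _ = []
Unique-++⁻ˡ (x ∷ xs) (x∉ ∷ uniq) = All.tabulate (λ z∈xs → All.lookup x∉ (∈-++⁺ˡ z∈xs)) ∷ Unique-++⁻ˡ xs uniq

Unique-++⁻ʳ : ∀ xs {ys : List ℕ} → Unique (xs ++ ys) → Unique ys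
Unique-++⁻ʳ [] uniq = uniq
Unique-++⁻ʳ (x ∷ xs) (_ ∷ uniq) = Unique-++⁻ʳ xs uniq

Unique-++⇒disjoint : ∀ xs {ys : List ℕ} {x} → Unique (xs ++ ys) → x ∈ xs → x ∉ ys
Unique-++⇒disjoint (_ ∷ xs) (x∉ ∷ _) (here refl) x∈ys = All.lookup x∉ (∈-++⁺ʳ xs x∈ys) refl
Unique-++⇒disjoint (_ ∷ xs) (_ ∷ uniq) (there x∈xs) = Unique-++⇒disjoint xs uniq x∈xs

Unique-delete : ∀ xs {y} {ys : List ℕ} → Unique (xs ++ y ∷ ys) → Unique (xs ++ ys)
Unique-delete [] (_ ∷ uniq) = uniq
Unique-delete (x ∷ xs) (x∉ ∷ uniq) = All.tabulate (λ z∈ → All.lookup x∉ (skip z∈)) ∷ Unique-delete xs uniq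
  where
  skip : xs ++ _ ⊆ xs ++ _ ∷ _
  skip z∈ with ∈-++⁻ xs z∈
  ... | inj₁ z∈xs = ∈-++⁺ˡ z∈xs
  ... | inj₂ z∈ys = ∈-++⁺ʳ xs (there z∈ys)

length-mono-⊆ : ∀ {xs ys : List ℕ} → Unique xs → xs ⊆ ys → length xs ≤ length ys
length-mono-⊆ {[]} _ _ = z≤n
length-mono-⊆ {x ∷ xs} (x∉ ∷ uniq) xs⊆ys with ∈-∃++ (xs⊆ys (here refl))
... | as , bs , refl = ≤-trans (s≤s (length-mono-⊆ uniq avoid)) (≤-reflexive (sym length-insert))
  where
  avoid : xs ⊆ as ++ bs
  avoid {y} y∈xs with ∈-++⁻ as (xs⊆ys (there y∈xs))
  ... | inj₁ y∈as = ∈-++⁺ˡ y∈as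
  ... | inj₂ (here refl) = ⊥-elim (All.lookup x∉ y∈xs refl)
  ... | inj₂ (there y∈bs) = ∈-++⁺ʳ as y∈bs
  length-insert : length (as ++ x ∷ bs) ≡ suc (length (as ++ bs))
  length-insert = trans (length-++ as) (trans (+-suc (length as) _) (cong suc (sym (length-++ as))))

take⊆ : ∀ c (xs : List ℕ) → take c xs ⊆ xs
take⊆ c xs x∈ = subst (_ ∈_) (take++drop≡id c xs) (∈-++⁺ˡ x∈)

drop⊆ : ∀ c (xs : List ℕ) → drop c xs ⊆ xs
drop⊆ c xs x∈ = subst (_ ∈_) (take++drop≡id c xs) (∈-++⁺ʳ (take c xs) x∈)

Unique-map⁺-∈ : ∀ (f : ℕ → ℕ) {xs} → (∀ {x y} → x ∈ xs → y ∈ xs → f x ≡ f y → x ≡ y) →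
                Unique xs → Unique (map f xs)
Unique-map⁺-∈ f {[]} _ [] = []
Unique-map⁺-∈ f {x ∷ xs} inj (x∉ ∷ uniq) =
  All.tabulate fresh ∷ Unique-map⁺-∈ f (λ x∈ y∈ → inj (there x∈) (there y∈)) uniq
  where
  fresh : ∀ {z} → z ∈ map f xs → f x ≢ z
  fresh z∈ eq with ∈-map⁻ f z∈
  ... | y , y∈xs , refl = All.lookup x∉ y∈xs (inj (here refl) (there y∈xs) eq)

interval : ℕ → ℕ → List ℕ
interval lo zero = []
interval lo (suc n) = lo ∷ interval (suc lo) n

length-interval : ∀ lo n → length (interval lo n) ≡ n
length-interval lo zero = refl
length-interval lo (suc n) = cong suc (length-interval (suc lo) n)

∈-interval⁺ : ∀ {x} lo n → lo ≤ x → x < lo + n → x ∈ interval lo n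
∈-interval⁺ {x} lo zero lo≤x x<lo+0 = ⊥-elim (<⇒≱ x<lo+0 (≤-trans (≤-reflexive (+-identityʳ lo)) lo≤x))
∈-interval⁺ {x} lo (suc n) lo≤x x<lo+1+n with lo ≟ x
... | yes refl = here refl
... | no lo≢x = there (∈-interval⁺ (suc lo) n (≤∧≢⇒< lo≤x lo≢x) (subst (x <_) (+-suc lo n) x<lo+1+n))

∈-interval⁻ : ∀ {x} lo n → x ∈ interval lo n → lo ≤ x × x < lo + n
∈-interval⁻ lo (suc n) (here refl) = ≤-refl , ≤-trans (s≤s (m≤m+n lo n)) (≤-reflexive (sym (+-suc lo n)))
∈-interval⁻ {x} lo (suc n) (there x∈) with ∈-interval⁻ (suc lo) n x∈
... | lo<x , x<1+lo+n = <⇒≤ lo<x , subst (x <_) (sym (+-suc lo n)) x<1+lo+n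

interval-unique : ∀ lo n → Unique (interval lo n)
interval-unique lo zero = []
interval-unique lo (suc n) =
  All.tabulate (λ x∈ → <⇒≢ (proj₁ (∈-interval⁻ (suc lo) n x∈))) ∷ interval-unique (suc lo) n

interval-++ : ∀ lo m n → interval lo (m + n) ≡ interval lo m ++ interval (lo + m) n
interval-++ lo zero n = cong (λ lo′ → interval lo′ n) (sym (+-identityʳ lo))
interval-++ lo (suc m) n =
  cong (lo ∷_) (trans (interval-++ (suc lo) m n) (cong (λ lo′ → interval (suc lo) m ++ interval lo′ n) (sym (+-suc lo m))))

map-interval-+ : ∀ (f : ℕ → ℕ) k lo n → map f (interval (k + lo) n) ≡ map (λ x → f (k + x)) (interval lo n)
map-interval-+ f k lo zero = refl
map-interval-+ f k lo (suc n) =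
  cong (f (k + lo) ∷_) (trans (cong (λ lo′ → map f (interval lo′ n)) (sym (+-suc k lo))) (map-interval-+ f k (suc lo) n))

applyUpTo-interval : ∀ {f : ℕ → ℕ} lo n → (∀ i → f i ≡ lo + i) → applyUpTo f n ≡ interval lo n
applyUpTo-interval lo zero _ = refl
applyUpTo-interval lo (suc n) f≗lo+ =
  cong₂ _∷_ (trans (f≗lo+ 0) (+-identityʳ lo)) (applyUpTo-interval (suc lo) n (λ i → trans (f≗lo+ (suc i)) (+-suc lo i)))

length≤width : ∀ {xs} lo n → Unique xs → (∀ {x} → x ∈ xs → lo ≤ x × x < lo + n) → length xs ≤ n
length≤width lo n uniq inside = ≤-trans
  (length-mono-⊆ uniq (λ x∈ → ∈-interval⁺ lo n (proj₁ (inside x∈)) (proj₂ (inside x∈))))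
  (≤-reflexive (length-interval lo n))

permutation-maxW≡length : ∀ {w} → IsPermutation w → maxW w ≡ length w
permutation-maxW≡length {w} ((positive , covered) , uniq) = ≤-antisym
  (≤-trans (≤-reflexive (sym (length-interval 1 (maxW w))))
    (length-mono-⊆ (interval-unique 1 (maxW w))
      (λ k∈ → let (1≤k , k<1+m) = ∈-interval⁻ 1 (maxW w) k∈ in covered _ 1≤k (≤-pred k<1+m))))
  (length≤width 1 (maxW w) uniq (λ x∈ → All.lookup positive x∈ , s≤s (∈⇒≤maxW x∈)))

permutation-∈ : ∀ {w k} → IsPermutation w → 1 ≤ k → k ≤ length w → k ∈ w
permutation-∈ perm@((_ , covered) , _) 1≤k k≤n =
  covered _ 1≤k (≤-trans k≤n (≤-reflexive (sym (permutation-maxW≡length perm))))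

permutation-bounds : ∀ {w x} → IsPermutation w → x ∈ w → 1 ≤ x × x ≤ length w
permutation-bounds perm@((positive , _) , _) x∈w =
  All.lookup positive x∈w , ≤-trans (∈⇒≤maxW x∈w) (≤-reflexive (permutation-maxW≡length perm))

-- The letter at a 1-based position, as positionOf counts; 0 outside 1 … |w|.
at : Word → ℕ → ℕ
at [] _ = 0
at (_ ∷ _) zero = 0
at (x ∷ _) (suc zero) = x
at (_ ∷ xs) (suc (suc p)) = at xs (suc p)

at-∷ : ∀ x {xs p} → 1 ≤ p → at (x ∷ xs) (suc p) ≡ at xs p
at-∷ x {p = suc p} _ = refl

positionOf-here : ∀ {t x} xs → t ≡ x → positionOf t (x ∷ xs) ≡ 1
positionOf-here {t} _ refl with t ≡ᵇ t | ≡⇒≡ᵇ t t refl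
... | true | _ = refl

positionOf-there : ∀ {t x} xs → t ≢ x → positionOf t (x ∷ xs) ≡ suc (positionOf t xs)
positionOf-there {t} {x} _ t≢x with t ≡ᵇ x | ≡ᵇ⇒≡ t x
... | false | _ = refl
... | true | t≡x = ⊥-elim (t≢x (t≡x _))

positionOf-bounds : ∀ {t xs} → t ∈ xs → 1 ≤ positionOf t xs × positionOf t xs ≤ length xs
positionOf-bounds {t} {x ∷ xs} t∈ with t ≟ x | t∈
... | yes t≡x | _ rewrite positionOf-here xs t≡x = s≤s z≤n , s≤s z≤n
... | no t≢x | here t≡x = ⊥-elim (t≢x t≡x)
... | no t≢x | there t∈xs rewrite positionOf-there xs t≢x = s≤s z≤n , s≤s (proj₂ (positionOf-bounds t∈xs))

at-positionOf : ∀ {t xs} → t ∈ xs → at xs (positionOf t xs) ≡ t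
at-positionOf {t} {x ∷ xs} t∈ with t ≟ x | t∈
... | yes t≡x | _ rewrite positionOf-here xs t≡x = sym t≡x
... | no t≢x | here t≡x = ⊥-elim (t≢x t≡x)
... | no t≢x | there t∈xs rewrite positionOf-there xs t≢x =
      trans (at-∷ x (proj₁ (positionOf-bounds t∈xs))) (at-positionOf t∈xs)

at-∈ : ∀ xs {p} → 1 ≤ p → p ≤ length xs → at xs p ∈ xs
at-∈ (x ∷ xs) {suc zero} _ _ = here refl
at-∈ (x ∷ xs) {suc (suc p)} _ (s≤s p≤n) = there (at-∈ xs (s≤s z≤n) p≤n)

positionOf-at : ∀ {xs p} → Unique xs → 1 ≤ p → p ≤ length xs → positionOf (at xs p) xs ≡ p
positionOf-at {x ∷ xs} {suc zero} _ _ _ = positionOf-here xs refl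
positionOf-at {x ∷ xs} {suc (suc p)} (x∉ ∷ uniq) _ (s≤s p≤n) = trans
  (positionOf-there xs (λ eq → All.lookup x∉ (at-∈ xs (s≤s z≤n) p≤n) (sym eq)))
  (cong suc (positionOf-at uniq (s≤s z≤n) p≤n))

positionOf-++-∈ : ∀ {t} xs ys → t ∈ xs → positionOf t (xs ++ ys) ≡ positionOf t xs
positionOf-++-∈ {t} (x ∷ xs) ys t∈ with t ≟ x | t∈
... | yes t≡x | _ = trans (positionOf-here (xs ++ ys) t≡x) (sym (positionOf-here xs t≡x))
... | no t≢x | here t≡x = ⊥-elim (t≢x t≡x)
... | no t≢x | there t∈xs = trans (positionOf-there (xs ++ ys) t≢x)
      (trans (cong suc (positionOf-++-∈ xs ys t∈xs)) (sym (positionOf-there xs t≢x)))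

positionOf-++-∉ : ∀ {t} xs ys → t ∉ xs → positionOf t (xs ++ ys) ≡ length xs + positionOf t ys
positionOf-++-∉ [] ys _ = refl
positionOf-++-∉ (x ∷ xs) ys t∉ =
  trans (positionOf-there (xs ++ ys) (λ t≡x → t∉ (here t≡x))) (cong suc (positionOf-++-∉ xs ys (λ t∈ → t∉ (there t∈))))

positionOf-map : ∀ (f : ℕ → ℕ) → (∀ {x y} → f x ≡ f y → x ≡ y) → ∀ {t} xs → positionOf (f t) (map f xs) ≡ positionOf t xs
positionOf-map f f-inj [] = refl
positionOf-map f f-inj {t} (x ∷ xs) with t ≟ x
... | yes t≡x = trans (positionOf-here (map f xs) (cong f t≡x)) (sym (positionOf-here xs t≡x))
... | no t≢x = trans (positionOf-there (map f xs) (λ eq → t≢x (f-inj eq)))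
      (trans (cong suc (positionOf-map f f-inj xs)) (sym (positionOf-there xs t≢x)))

at-map-interval : ∀ (f : ℕ → ℕ) lo n {q} → q < n → at (map f (interval lo n)) (suc q) ≡ f (lo + q)
at-map-interval f lo (suc n) {zero} _ = cong f (sym (+-identityʳ lo))
at-map-interval f lo (suc n) {suc q} (s≤s q<n) = trans (at-map-interval f (suc lo) n q<n) (cong f (sym (+-suc lo q)))

at-extensionality : ∀ {xs ys} → length xs ≡ length ys →
                    (∀ p → 1 ≤ p → p ≤ length xs → at xs p ≡ at ys p) → xs ≡ ys
at-extensionality {[]} {[]} _ _ = refl
at-extensionality {x ∷ xs} {y ∷ ys} len≡ at≡ = cong₂ _∷_ (at≡ 1 (s≤s z≤n) (s≤s z≤n))
  (at-extensionality (suc-injective len≡) (λ { (suc p) _ p≤n → at≡ (suc (suc p)) (s≤s z≤n) (s≤s p≤n) }))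

inverse-interval : ∀ σ → inverse σ ≡ map (λ t → positionOf t σ) (interval 1 (length σ))
inverse-interval σ = cong (map (λ t → positionOf t σ)) (trans (map-upTo suc (length σ)) (applyUpTo-interval 1 (length σ) (λ _ → refl)))

length-inverse : ∀ σ → length (inverse σ) ≡ length σ
length-inverse σ = trans (cong length (inverse-interval σ)) (trans (length-map _ (interval 1 (length σ))) (length-interval 1 (length σ)))

inverse-≡[] : ∀ {σ} → inverse σ ≡ [] → σ ≡ []
inverse-≡[] {[]} _ = refl
inverse-≡[] {x ∷ σ} eq with trans (sym (length-inverse (x ∷ σ))) (cong length eq)
... | ()

at-inverse : ∀ σ {p} → 1 ≤ p → p ≤ length σ → at (inverse σ) p ≡ positionOf p σ
at-inverse σ {suc q} _ q<n = trans (cong (λ w → at w (suc q)) (inverse-interval σ)) (at-map-interval _ 1 (length σ) q<n)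

inverse-permutation : ∀ {σ} → IsPermutation σ → IsPermutation (inverse σ)
inverse-permutation {σ} perm@(_ , uniq) = (All.tabulate positive , covered) , unique
  where
  n = length σ
  position = λ t → positionOf t σ
  inverse≡ = inverse-interval σ
  interval⊆σ : ∀ {t} → t ∈ interval 1 n → t ∈ σ
  interval⊆σ t∈ = let (1≤t , t<1+n) = ∈-interval⁻ 1 n t∈ in permutation-∈ perm 1≤t (≤-pred t<1+n)
  letter : ∀ {x} → x ∈ inverse σ → ∃ λ t → t ∈ σ × x ≡ position t
  letter x∈ with ∈-map⁻ position (subst (_ ∈_) inverse≡ x∈)
  ... | t , t∈ , refl = t , interval⊆σ t∈ , refl
  positive : ∀ {x} → x ∈ inverse σ → 1 ≤ x
  positive x∈ with letter x∈
  ... | t , t∈σ , refl = proj₁ (positionOf-bounds t∈σ)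
  maxW≤n : maxW (inverse σ) ≤ n
  maxW≤n = maxW-≤ ≤n
    where
    ≤n : ∀ {x} → x ∈ inverse σ → x ≤ n
    ≤n x∈ with letter x∈
    ... | t , t∈σ , refl = proj₂ (positionOf-bounds t∈σ)
  covered : ∀ k → 1 ≤ k → k ≤ maxW (inverse σ) → k ∈ inverse σ
  covered k 1≤k k≤max = subst (k ∈_) (sym inverse≡)
    (subst (_∈ map position (interval 1 n)) (positionOf-at uniq 1≤k k≤n) (∈-map⁺ position σₖ∈))
    where
    k≤n = ≤-trans k≤max maxW≤n
    σₖ∈ : at σ k ∈ interval 1 n
    σₖ∈ = let (1≤σₖ , σₖ≤n) = permutation-bounds perm (at-∈ σ 1≤k k≤n) in ∈-interval⁺ 1 n 1≤σₖ (s≤s σₖ≤n)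
  unique : Unique (inverse σ)
  unique = subst Unique (sym inverse≡) (Unique-map⁺-∈ position
    (λ x∈ y∈ eq → trans (sym (at-positionOf (interval⊆σ x∈))) (trans (cong (at σ) eq) (at-positionOf (interval⊆σ y∈))))
    (interval-unique 1 n))

maxW-inverse : ∀ {σ} → IsPermutation σ → maxW (inverse σ) ≡ length σ
maxW-inverse {σ} perm = trans (permutation-maxW≡length (inverse-permutation perm)) (length-inverse σ)

inverse-involutive : ∀ {σ} → IsPermutation σ → inverse (inverse σ) ≡ σ
inverse-involutive {σ} perm@(_ , uniq) =
  at-extensionality (trans (length-inverse (inverse σ)) (length-inverse σ)) at-agrees
  where
  at-agrees : ∀ p → 1 ≤ p → p ≤ length (inverse (inverse σ)) → at (inverse (inverse σ)) p ≡ at σ p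
  at-agrees p 1≤p p≤ = begin
      at (inverse (inverse σ)) p          ≡⟨ at-inverse (inverse σ) 1≤p p≤n′ ⟩
      positionOf p (inverse σ)            ≡⟨ cong (λ q → positionOf q (inverse σ)) (sym τσₚ≡p) ⟩
      positionOf (at (inverse σ) σₚ) (inverse σ) ≡⟨ positionOf-at (proj₂ (inverse-permutation perm)) 1≤σₚ (≤-trans σₚ≤n (≤-reflexive (sym (length-inverse σ)))) ⟩
      σₚ                                  ∎
    where
    open ≡-Reasoning
    p≤n′ = ≤-trans p≤ (≤-reflexive (length-inverse (inverse σ)))
    p≤n = ≤-trans p≤n′ (≤-reflexive (length-inverse σ))
    σₚ = at σ p
    bounds = permutation-bounds perm (at-∈ σ 1≤p p≤n)
    1≤σₚ = proj₁ bounds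
    σₚ≤n = proj₂ bounds
    τσₚ≡p : at (inverse σ) σₚ ≡ p
    τσₚ≡p = trans (at-inverse σ 1≤σₚ σₚ≤n) (positionOf-at uniq 1≤p p≤n)

positionOf-∈-take : ∀ c xs {x} → x ∈ take c xs → positionOf x xs ≤ c
positionOf-∈-take (suc c) (y ∷ ys) {x} x∈ with x ≟ y | x∈
... | yes x≡y | _ = ≤-trans (≤-reflexive (positionOf-here ys x≡y)) (s≤s z≤n)
... | no x≢y | here x≡y = ⊥-elim (x≢y x≡y)
... | no x≢y | there x∈ys = ≤-trans (≤-reflexive (positionOf-there ys x≢y)) (s≤s (positionOf-∈-take c ys x∈ys))

positionOf-∈-drop : ∀ c {xs x} → Unique xs → x ∈ drop c xs → c < positionOf x xs
positionOf-∈-drop zero _ x∈ = proj₁ (positionOf-bounds x∈)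
positionOf-∈-drop (suc c) {y ∷ ys} {x} (y∉ ∷ uniq) x∈ = ≤-trans
  (s≤s (positionOf-∈-drop c uniq x∈))
  (≤-reflexive (sym (positionOf-there ys (λ x≡y → All.lookup y∉ (drop⊆ c ys x∈) (sym x≡y)))))

at-∈-take : ∀ c xs {p} → 1 ≤ p → p ≤ c → p ≤ length xs → at xs p ∈ take c xs
at-∈-take (suc c) (x ∷ xs) {suc zero} _ _ _ = here refl
at-∈-take (suc c) (x ∷ xs) {suc (suc p)} _ (s≤s p≤c) (s≤s p≤n) = there (at-∈-take c xs (s≤s z≤n) p≤c p≤n)

at-∈-drop : ∀ c xs {p} → c < p → p ≤ length xs → at xs p ∈ drop c xs
at-∈-drop zero xs c<p p≤n = at-∈ xs c<p p≤n
at-∈-drop (suc c) (x ∷ xs) {suc (suc p)} (s≤s c<p) (s≤s p≤n) = at-∈-drop c xs c<p p≤n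

module _ {w c} (perm : IsPermutation w) (descent : IsGlobalDescent w c) where

  private
    n = length w
    c<n = proj₁ (proj₂ descent)
    below : ∀ {a b} → a ∈ take c w → b ∈ drop c w → b < a
    below a∈ b∈ = All.lookup (All.lookup (proj₂ (proj₂ descent)) a∈) b∈

  globalDescent-take-bound : ∀ {a} → a ∈ take c w → n ∸ c < a
  globalDescent-take-bound {a} a∈ with n ∸ c <? a | proj₁ (permutation-bounds perm (take⊆ c w a∈))
  ... | yes n∸c<a | _ = n∸c<a
  ... | no n∸c≮a | s≤s {n = a′} _ = ⊥-elim (<⇒≱ (≮⇒≥ n∸c≮a) (begin
      n ∸ c                ≡⟨ sym (length-drop c w) ⟩
      length (drop c w)    ≤⟨ length≤width 1 a′ (Unique.drop⁺ c (proj₂ perm))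
                                (λ b∈ → proj₁ (permutation-bounds perm (drop⊆ c w b∈)) , below a∈ b∈) ⟩
      a′                   ∎))
    where open ≤-Reasoning

  globalDescent-drop-bound : ∀ {b} → b ∈ drop c w → b ≤ n ∸ c
  globalDescent-drop-bound {b} b∈ with b ≤? n ∸ c
  ... | yes b≤n∸c = b≤n∸c
  ... | no b≰n∸c = ⊥-elim (<-irrefl refl (begin-strict
      c                          ≡⟨ sym (m≤n⇒m⊓n≡m (<⇒≤ c<n)) ⟩
      c ⊓ n                      ≡⟨ sym (length-take c w) ⟩
      length (take c w)          <⟨ s≤s ≤-refl ⟩
      length (b ∷ take c w)      ≤⟨ length≤width (suc (n ∸ c)) c unique inside ⟩
      c                          ∎))
    where
    open ≤-Reasoning
    unique : Unique (b ∷ take c w)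
    unique = All.tabulate (λ a∈ → <⇒≢ (below a∈ b∈)) ∷ Unique.take⁺ c (proj₂ perm)
    top : suc (n ∸ c) + c ≡ suc n
    top = cong suc (m∸n+n≡m (<⇒≤ c<n))
    inside : ∀ {x} → x ∈ b ∷ take c w → suc (n ∸ c) ≤ x × x < suc (n ∸ c) + c
    inside (here refl) = ≰⇒> b≰n∸c , subst (b <_) (sym top) (s≤s (proj₂ (permutation-bounds perm (drop⊆ c w b∈))))
    inside {x} (there x∈) = globalDescent-take-bound x∈ , subst (x <_) (sym top) (s≤s (proj₂ (permutation-bounds perm (take⊆ c w x∈))))

inverse-globalDescent : ∀ {σ c} → IsPermutation σ → IsGlobalDescent (inverse σ) c → IsGlobalDescent σ (length σ ∸ c)
inverse-globalDescent {σ} {c} perm descent@(1≤c , c<|τ| , _) =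
  m<n⇒0<n∸m c<n , ∸-monoʳ-< 1≤c (<⇒≤ c<n) , All.tabulate (λ a∈ → All.tabulate (λ b∈ → ≤-<-trans (b≤c b∈) (c<a a∈)))
  where
  n = length σ
  τ = inverse σ
  τ-perm = inverse-permutation perm
  |τ|≡n = length-inverse σ
  c<n = subst (c <_) |τ|≡n c<|τ|
  bounds : ∀ {x} → x ∈ σ → 1 ≤ x × x ≤ length τ
  bounds x∈ = let (1≤x , x≤n) = permutation-bounds perm x∈ in 1≤x , subst (_ ≤_) (sym |τ|≡n) x≤n
  τ-at : ∀ {x} → x ∈ σ → at τ x ≡ positionOf x σ
  τ-at x∈ = let (1≤x , x≤n) = permutation-bounds perm x∈ in at-inverse σ 1≤x x≤n
  τ-take-bound : ∀ {x} → x ∈ take c τ → n ∸ c < x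
  τ-take-bound x∈ = subst (λ m → m ∸ c < _) |τ|≡n (globalDescent-take-bound τ-perm descent x∈)
  τ-drop-bound : ∀ {x} → x ∈ drop c τ → x ≤ n ∸ c
  τ-drop-bound x∈ = subst (λ m → _ ≤ m ∸ c) |τ|≡n (globalDescent-drop-bound τ-perm descent x∈)
  c<a : ∀ {a} → a ∈ take (n ∸ c) σ → c < a
  c<a {a} a∈ with c <? a
  ... | yes c<a = c<a
  ... | no c≮a = ⊥-elim (<⇒≱ (subst (n ∸ c <_) (τ-at a∈σ) (τ-take-bound (at-∈-take c τ 1≤a (≮⇒≥ c≮a) a≤|τ|)))
                             (positionOf-∈-take (n ∸ c) σ a∈))
    where
    a∈σ = take⊆ (n ∸ c) σ a∈
    1≤a = proj₁ (bounds a∈σ)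
    a≤|τ| = proj₂ (bounds a∈σ)
  b≤c : ∀ {b} → b ∈ drop (n ∸ c) σ → b ≤ c
  b≤c {b} b∈ with b ≤? c
  ... | yes b≤c = b≤c
  ... | no b≰c = ⊥-elim (<⇒≱ (positionOf-∈-drop (n ∸ c) (proj₂ perm) b∈)
                             (subst (_≤ n ∸ c) (τ-at b∈σ) (τ-drop-bound (at-∈-drop c τ (≰⇒> b≰c) (proj₂ (bounds b∈σ))))))
    where
    b∈σ = drop⊆ (n ∸ c) σ b∈

irreducible-inverse : ∀ {σ} → IsPermutation σ → Irreducible σ → Irreducible (inverse σ)
irreducible-inverse {σ} perm (σ≢[] , no-descent) =
  (λ τ≡[] → σ≢[] (inverse-≡[] τ≡[])) ,
  (λ (c , descent) → no-descent (length σ ∸ c , inverse-globalDescent perm descent))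

⊙-permutation : ∀ {a u} → IsPermutation a → IsPermutation u → IsPermutation (a ⊙ u)
⊙-permutation {a} {u} ((a-positive , a-covered) , a-unique) ((u-positive , u-covered) , u-unique) =
  (All.tabulate positive , covered) , unique
  where
  K = maxW u
  above : ∀ {y} → y ∈ shift K a → K < y
  above y∈ with ∈-map⁻ (K +_) y∈
  ... | z , z∈a , refl = subst (_≤ K + z) (+-comm K 1) (+-monoʳ-≤ K (All.lookup a-positive z∈a))
  unique : Unique (shift K a ++ u)
  unique = Unique.++⁺ (Unique.map⁺ (+-cancelˡ-≡ K _ _) a-unique) u-unique
    (λ (y∈a , y∈u) → <⇒≱ (above y∈a) (∈⇒≤maxW y∈u))
  positive : ∀ {y} → y ∈ shift K a ++ u → 1 ≤ y
  positive y∈ with ∈-++⁻ (shift K a) y∈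
  ... | inj₁ y∈a = ≤-trans (s≤s z≤n) (above y∈a)
  ... | inj₂ y∈u = All.lookup u-positive y∈u
  covered : ∀ k → 1 ≤ k → k ≤ maxW (shift K a ++ u) → k ∈ shift K a ++ u
  covered k 1≤k k≤max with k ≤? K
  ... | yes k≤K = ∈-++⁺ʳ (shift K a) (u-covered k 1≤k k≤K)
  ... | no k≰K = ∈-++⁺ˡ (subst (_∈ shift K a) (m+[n∸m]≡n (<⇒≤ K<k))
          (∈-map⁺ (K +_) (a-covered (k ∸ K) (m<n⇒0<n∸m K<k) k∸K≤maxW)))
    where
    K<k = ≰⇒> k≰K
    k∸K≤maxW : k ∸ K ≤ maxW a
    k∸K≤maxW = m≤n+o⇒m∸n≤o k K (subst (k ≤_) (maxW-⊙ a u) k≤max)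

ψ∘-permutation : ∀ {x l} → IsPermutation x → 1 ≤ l → l ≤ suc (maxW x) → IsPermutation (ψ ∘ l x)
ψ∘-permutation {x} {l} ((positive , covered) , uniq) 1≤l l≤1+max =
  (All.tabulate positive′ , covered′) , unique′
  where
  bumped = map (bump l) x
  unique′ : Unique (bumped ++ [ l ])
  unique′ = Unique.++⁺ (Unique.map⁺ (bump-injective l) uniq) ([] ∷ [])
    (λ { (y∈ , here refl) → let (z , _ , y≡) = ∈-map⁻ (bump l) y∈ in bump≢ l z (sym y≡) })
  letter : ∀ {y} → y ∈ bumped ++ [ l ] → y ≡ l ⊎ ∃ λ z → z ∈ x × y ≡ bump l z
  letter y∈ with ∈-++⁻ bumped y∈
  ... | inj₁ y∈bumped = inj₂ (∈-map⁻ (bump l) y∈bumped)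
  ... | inj₂ (here y≡l) = inj₁ y≡l
  positive′ : ∀ {y} → y ∈ bumped ++ [ l ] → 1 ≤ y
  positive′ y∈ with letter y∈
  ... | inj₁ refl = 1≤l
  ... | inj₂ (z , z∈x , refl) = ≤-trans (All.lookup positive z∈x) (n≤bump l z)
  maxW≤ : maxW (bumped ++ [ l ]) ≤ suc (maxW x)
  maxW≤ = maxW-≤ bound
    where
    bound : ∀ {y} → y ∈ bumped ++ [ l ] → y ≤ suc (maxW x)
    bound y∈ with letter y∈
    ... | inj₁ refl = l≤1+max
    ... | inj₂ (z , z∈x , refl) = ≤-trans (bump≤suc l z) (s≤s (∈⇒≤maxW z∈x))
  covered′ : ∀ k → 1 ≤ k → k ≤ maxW (bumped ++ [ l ]) → k ∈ bumped ++ [ l ]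
  covered′ k 1≤k k≤max with k ≟ l | k <? l
  ... | yes refl | _ = ∈-++⁺ʳ bumped (here refl)
  ... | no _ | yes k<l = ∈-++⁺ˡ (subst (_∈ bumped) (bump-< k<l)
          (∈-map⁺ (bump l) (covered k 1≤k (≤-pred (≤-trans k<l l≤1+max)))))
  ... | no k≢l | no k≮l with k | ≤∧≢⇒< (≮⇒≥ k≮l) (λ l≡k → k≢l (sym l≡k))
  ...   | suc k′ | s≤s l≤k′ = ∈-++⁺ˡ (subst (_∈ bumped) (bump-≥ l≤k′)
          (∈-map⁺ (bump l) (covered k′ (≤-trans 1≤l l≤k′) (≤-pred (≤-trans k≤max maxW≤)))))

-- The singleton {j + 1} ⊆ {1 … j + 1 + r}.
mask : ℕ → ℕ → List Bool
mask j r = replicate j false ++ true ∷ replicate r false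

countTrue-replicate-false : ∀ r → countTrue (replicate r false) ≡ 0
countTrue-replicate-false zero = refl
countTrue-replicate-false (suc r) = countTrue-replicate-false r

countTrue-mask : ∀ j r → countTrue (mask j r) ≡ 1
countTrue-mask zero r = cong suc (countTrue-replicate-false r)
countTrue-mask (suc j) r = countTrue-mask j r

length-mask : ∀ j r → length (mask j r) ≡ j + suc r
length-mask zero r = cong suc (length-replicate r)
length-mask (suc j) r = cong suc (length-mask j r)

countTrue≡0⇒replicate : ∀ I → countTrue I ≡ 0 → I ≡ replicate (length I) false
countTrue≡0⇒replicate [] _ = refl
countTrue≡0⇒replicate (false ∷ I) none = cong (false ∷_) (countTrue≡0⇒replicate I none)

countTrue≡1⇒mask : ∀ I → countTrue I ≡ 1 → ∃ λ j → ∃ λ r → I ≡ mask j r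
countTrue≡1⇒mask (true ∷ I) one = 0 , length I , cong (true ∷_) (countTrue≡0⇒replicate I (suc-injective one))
countTrue≡1⇒mask (false ∷ I) one with countTrue≡1⇒mask I one
... | j , r , I≡ = suc j , r , cong (false ∷_) I≡

phiAux-replicate-false : ∀ N r ws → phiAux N (replicate r false) ws ≡ ws
phiAux-replicate-false N zero ws = refl
phiAux-replicate-false N (suc r) [] = phiAux-replicate-false N r []
phiAux-replicate-false N (suc r) (x ∷ ws) = cong (x ∷_) (phiAux-replicate-false N r ws)

phiAux-++ : ∀ N I {m} xs ys → length xs ≡ m → phiAux N (replicate m false ++ I) (xs ++ ys) ≡ xs ++ phiAux N I ys
phiAux-++ N I [] ys refl = refl
phiAux-++ N I (x ∷ xs) ys refl = cong (x ∷_) (phiAux-++ N I xs ys refl)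

phiAux-mask : ∀ N j r ws → phiAux N (mask j r) ws ≡ take j ws ++ N ∷ drop j ws
phiAux-mask N zero r ws = cong (N ∷_) (phiAux-replicate-false N r ws)
phiAux-mask N (suc j) r [] = trans (phiAux-mask N j r []) (cong₂ (λ xs ys → xs ++ N ∷ ys) (take-[] j) (drop-[] j))
phiAux-mask N (suc j) r (x ∷ ws) = cong (x ∷_) (phiAux-mask N j r ws)

∈-phiAux : ∀ N I ws → 1 ≤ countTrue I → N ∈ phiAux N I ws
∈-phiAux N (true ∷ I) ws _ = here refl
∈-phiAux N (false ∷ I) [] 1≤count = ∈-phiAux N I [] 1≤count
∈-phiAux N (false ∷ I) (x ∷ ws) 1≤count = there (∈-phiAux N I ws 1≤count)

Unique-phiAux⇒countTrue≤1 : ∀ N I ws → Unique (phiAux N I ws) → countTrue I ≤ 1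
Unique-phiAux⇒countTrue≤1 N [] ws _ = z≤n
Unique-phiAux⇒countTrue≤1 N (true ∷ I) ws (N∉ ∷ _) with countTrue I in count≡
... | zero = s≤s z≤n
... | suc _ = ⊥-elim (All.lookup N∉ (∈-phiAux N I ws (subst (1 ≤_) (sym count≡) (s≤s z≤n))) refl)
Unique-phiAux⇒countTrue≤1 N (false ∷ I) [] uniq = Unique-phiAux⇒countTrue≤1 N I [] uniq
Unique-phiAux⇒countTrue≤1 N (false ∷ I) (x ∷ ws) (_ ∷ uniq) = Unique-phiAux⇒countTrue≤1 N I ws uniq

Packed-insert-max : ∀ xs ys → Packed (xs ++ ys) → Packed (xs ++ suc (maxW (xs ++ ys)) ∷ ys)
Packed-insert-max xs ys (positive , covered) = All.tabulate positive′ , covered′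
  where
  N = suc (maxW (xs ++ ys))
  letter : ∀ {x} → x ∈ xs ++ N ∷ ys → x ≡ N ⊎ x ∈ xs ++ ys
  letter x∈ with ∈-++⁻ xs x∈
  ... | inj₁ x∈xs = inj₂ (∈-++⁺ˡ x∈xs)
  ... | inj₂ (here x≡N) = inj₁ x≡N
  ... | inj₂ (there x∈ys) = inj₂ (∈-++⁺ʳ xs x∈ys)
  positive′ : ∀ {x} → x ∈ xs ++ N ∷ ys → 1 ≤ x
  positive′ x∈ with letter x∈
  ... | inj₁ refl = s≤s z≤n
  ... | inj₂ x∈ws = All.lookup positive x∈ws
  bound : ∀ {x} → x ∈ xs ++ N ∷ ys → x ≤ N
  bound x∈ with letter x∈
  ... | inj₁ refl = ≤-refl
  ... | inj₂ x∈ws = ≤-trans (∈⇒≤maxW x∈ws) (n≤1+n _)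
  covered′ : ∀ k → 1 ≤ k → k ≤ maxW (xs ++ N ∷ ys) → k ∈ xs ++ N ∷ ys
  covered′ k 1≤k k≤max with k ≟ N
  ... | yes refl = ∈-++⁺ʳ xs (here refl)
  ... | no k≢N with ∈-++⁻ xs (covered k 1≤k (≤-pred (≤∧≢⇒< (≤-trans k≤max (maxW-≤ bound)) k≢N)))
  ...   | inj₁ k∈xs = ∈-++⁺ˡ k∈xs
  ...   | inj₂ k∈ys = ∈-++⁺ʳ xs (there k∈ys)

-- With k = |u| and ℓ = j + 1 + k, ψ ∘ ℓ (a ⊙ u) is S = map h a ++ u ++ [ ℓ ]; its inverse splits
-- along the values 1 … k, k + 1 … k + j, ℓ, ℓ + 1 … into the four blocks of φ.
module _ {u a : Word} (j r : ℕ) (u-perm : IsPermutation u) (a-perm : IsPermutation a) (|a|≡j+r : length a ≡ j + r) where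

  private
    k = length u
    ℓ = suc j + k
    N = suc ((j + r) + k)

    h : ℕ → ℕ
    h x = bump ℓ (k + x)

    S : Word
    S = map h a ++ u ++ [ ℓ ]

    P Q : ℕ → ℕ
    P t = positionOf t S
    Q t = positionOf t a

    blocks : Word
    blocks = map (λ t → (j + r) + positionOf t u) (interval 1 k) ++ map Q (interval 1 j) ++ N ∷ map Q (interval (suc j) r)

    |map-h-a| : length (map h a) ≡ j + r
    |map-h-a| = trans (length-map h a) |a|≡j+r

    u<ℓ : ∀ {x} → x ∈ u → x < ℓ
    u<ℓ x∈ = s≤s (≤-trans (proj₂ (permutation-bounds u-perm x∈)) (m≤n+m k j))

    k<h : ∀ {x} → x ∈ a → k < h x
    k<h {x} x∈ = ≤-trans (subst (_≤ k + x) (+-comm k 1) (+-monoʳ-≤ k (proj₁ (permutation-bounds a-perm x∈)))) (n≤bump ℓ (k + x))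

    P∘h : ∀ {s} → s ∈ a → P (h s) ≡ Q s
    P∘h s∈ = trans (positionOf-++-∈ (map h a) (u ++ [ ℓ ]) (∈-map⁺ h s∈))
                   (positionOf-map h (λ eq → +-cancelˡ-≡ k _ _ (bump-injective ℓ eq)) a)

    P-low : ∀ {t} → t ∈ interval 1 k → P t ≡ (j + r) + positionOf t u
    P-low {t} t∈ = begin
        positionOf t (map h a ++ u ++ [ ℓ ])   ≡⟨ positionOf-++-∉ (map h a) _ t∉ ⟩
        length (map h a) + positionOf t (u ++ [ ℓ ]) ≡⟨ cong₂ _+_ |map-h-a| (positionOf-++-∈ u [ ℓ ] t∈u) ⟩
        (j + r) + positionOf t u ∎
      where
      open ≡-Reasoning
      t≤k = ≤-pred (proj₂ (∈-interval⁻ 1 k t∈))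
      t∈u = permutation-∈ u-perm (proj₁ (∈-interval⁻ 1 k t∈)) t≤k
      t∉ : t ∉ map h a
      t∉ t∈ha with ∈-map⁻ h t∈ha
      ... | x , x∈a , refl = <⇒≱ (k<h x∈a) t≤k

    P-middle : ∀ {s} → s ∈ interval 1 j → P (k + s) ≡ Q s
    P-middle {s} s∈ = trans (cong P (sym (bump-< k+s<ℓ))) (P∘h s∈a)
      where
      bounds = ∈-interval⁻ 1 j s∈
      s≤j = ≤-pred (proj₂ bounds)
      s∈a = permutation-∈ a-perm (proj₁ bounds) (≤-trans s≤j (≤-trans (m≤m+n j r) (≤-reflexive (sym |a|≡j+r))))
      k+s<ℓ : k + s < ℓ
      k+s<ℓ = s≤s (≤-trans (+-monoʳ-≤ k s≤j) (≤-reflexive (+-comm k j)))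

    P-top : P (suc (k + j)) ≡ N
    P-top = begin
        positionOf (suc (k + j)) S                         ≡⟨ cong P (cong suc (+-comm k j)) ⟩
        positionOf ℓ (map h a ++ u ++ [ ℓ ])               ≡⟨ positionOf-++-∉ (map h a) _ ℓ∉ha ⟩
        length (map h a) + positionOf ℓ (u ++ [ ℓ ])       ≡⟨ cong (length (map h a) +_) (positionOf-++-∉ u [ ℓ ] ℓ∉u) ⟩
        length (map h a) + (k + positionOf ℓ [ ℓ ])        ≡⟨ cong₂ (λ m p → m + (k + p)) |map-h-a| (positionOf-here {ℓ} [] refl) ⟩
        (j + r) + (k + 1)                                  ≡⟨ trans (cong ((j + r) +_) (+-comm k 1)) (+-suc (j + r) k) ⟩
        N ∎
      where
      open ≡-Reasoning
      ℓ∉ha : ℓ ∉ map h a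
      ℓ∉ha ℓ∈ with ∈-map⁻ h ℓ∈
      ... | x , _ , ℓ≡ = bump≢ ℓ (k + x) (sym ℓ≡)
      ℓ∉u : ℓ ∉ u
      ℓ∉u ℓ∈ = <-irrefl refl (u<ℓ ℓ∈)

    P-high : ∀ {y} → y ∈ interval (suc j) r → P (suc k + y) ≡ Q y
    P-high {y} y∈ = trans (cong P (sym (bump-≥ ℓ≤k+y))) (P∘h y∈a)
      where
      bounds = ∈-interval⁻ (suc j) r y∈
      y∈a = permutation-∈ a-perm (≤-trans (s≤s z≤n) (proj₁ bounds)) (≤-trans (≤-pred (proj₂ bounds)) (≤-reflexive (sym |a|≡j+r)))
      ℓ≤k+y : ℓ ≤ k + y
      ℓ≤k+y = ≤-trans (≤-reflexive (+-comm (suc j) k)) (+-monoʳ-≤ k (proj₁ bounds))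

    ψ∘-⊙≡S : ψ ∘ (suc j + maxW u) (a ⊙ u) ≡ S
    ψ∘-⊙≡S rewrite permutation-maxW≡length u-perm = begin
        map (bump ℓ) (shift k a ++ u) ++ [ ℓ ]                   ≡⟨ cong (_++ [ ℓ ]) (map-++ (bump ℓ) (shift k a) u) ⟩
        (map (bump ℓ) (shift k a) ++ map (bump ℓ) u) ++ [ ℓ ]   ≡⟨ ++-assoc (map (bump ℓ) (shift k a)) _ _ ⟩
        map (bump ℓ) (shift k a) ++ map (bump ℓ) u ++ [ ℓ ]     ≡⟨ cong₂ (λ xs ys → xs ++ ys ++ [ ℓ ]) (sym (map-∘ a)) u-fixed ⟩
        S ∎
      where
      open ≡-Reasoning
      u-fixed : map (bump ℓ) u ≡ u
      u-fixed = map-id-local (All.tabulate (λ x∈ → bump-< (u<ℓ x∈)))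

    inverse-S≡blocks : inverse S ≡ blocks
    inverse-S≡blocks = begin
        inverse S
          ≡⟨ inverse-interval S ⟩
        map P (interval 1 (length S))
          ≡⟨ cong (λ n → map P (interval 1 n)) |S| ⟩
        map P (interval 1 (k + (j + suc r)))
          ≡⟨ cong (map P) (trans (interval-++ 1 k (j + suc r)) (cong (interval 1 k ++_) (interval-++ (suc k) j (suc r)))) ⟩
        map P (interval 1 k ++ interval (suc k) j ++ interval (suc (k + j)) (suc r))
          ≡⟨ trans (map-++ P (interval 1 k) _) (cong (map P (interval 1 k) ++_) (map-++ P (interval (suc k) j) _)) ⟩
        map P (interval 1 k) ++ map P (interval (suc k) j) ++ P (suc (k + j)) ∷ map P (interval (suc (suc (k + j))) r)
          ≡⟨ cong₂ (λ lo lo′ → map P (interval 1 k) ++ map P (interval lo j) ++ P (suc (k + j)) ∷ map P (interval lo′ r))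
                   (+-comm 1 k) (cong suc (sym (+-suc k j))) ⟩
        map P (interval 1 k) ++ map P (interval (k + 1) j) ++ P (suc (k + j)) ∷ map P (interval (suc k + suc j) r)
          ≡⟨ cong₂ (λ xs ys → map P (interval 1 k) ++ xs ++ P (suc (k + j)) ∷ ys) (map-interval-+ P k 1 j) (map-interval-+ P (suc k) (suc j) r) ⟩
        map P (interval 1 k) ++ map (λ s → P (k + s)) (interval 1 j) ++ P (suc (k + j)) ∷ map (λ y → P (suc k + y)) (interval (suc j) r)
          ≡⟨ cong₂ _++_ (map-cong-local (All.tabulate P-low))
               (cong₂ _++_ (map-cong-local (All.tabulate P-middle)) (cong₂ _∷_ P-top (map-cong-local (All.tabulate P-high)))) ⟩
        blocks ∎
      where
      open ≡-Reasoning
      |S| : length S ≡ k + (j + suc r)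
      |S| = begin
          length (map h a ++ u ++ [ ℓ ])       ≡⟨ length-++ (map h a) ⟩
          length (map h a) + length (u ++ [ ℓ ]) ≡⟨ cong₂ _+_ |map-h-a| (length-++ u) ⟩
          (j + r) + (k + 1)                  ≡⟨ +-rearrange j r k ⟩
          k + (j + suc r) ∎
        where
        +-rearrange : ∀ j r k → (j + r) + (k + 1) ≡ k + (j + suc r)
        +-rearrange = solve-∀

    φ≡blocks : φ (shiftMask k (mask j r)) (inverse u ⊙ inverse a) ≡ blocks
    φ≡blocks = begin
        φ (shiftMask k (mask j r)) (inverse u ⊙ inverse a)
          ≡⟨ cong₂ (λ m M → phiAux (suc m) (shiftMask k (mask j r)) (shift M (inverse u) ++ inverse a)) maxW-τ maxW-inverse-a ⟩
        phiAux N (replicate k false ++ mask j r) (shift (j + r) (inverse u) ++ inverse a)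
          ≡⟨ phiAux-++ N (mask j r) (shift (j + r) (inverse u)) (inverse a) (trans (length-map _ (inverse u)) (length-inverse u)) ⟩
        shift (j + r) (inverse u) ++ phiAux N (mask j r) (inverse a)
          ≡⟨ cong₂ (λ xs ys → xs ++ phiAux N (mask j r) ys) shifted-inverse-u split-inverse-a ⟩
        low ++ phiAux N (mask j r) (map Q (interval 1 j) ++ map Q (interval (suc j) r))
          ≡⟨ cong (low ++_) (phiAux-++ N (true ∷ replicate r false) (map Q (interval 1 j)) _
                                       (trans (length-map Q (interval 1 j)) (length-interval 1 j))) ⟩
        low ++ map Q (interval 1 j) ++ N ∷ phiAux N (replicate r false) (map Q (interval (suc j) r))
          ≡⟨ cong (λ ys → low ++ map Q (interval 1 j) ++ N ∷ ys) (phiAux-replicate-false N r _) ⟩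
        blocks ∎
      where
      open ≡-Reasoning
      low = map (λ t → (j + r) + positionOf t u) (interval 1 k)
      maxW-inverse-a : maxW (inverse a) ≡ j + r
      maxW-inverse-a = trans (maxW-inverse a-perm) |a|≡j+r
      maxW-τ : maxW (inverse u ⊙ inverse a) ≡ (j + r) + k
      maxW-τ = trans (maxW-⊙ (inverse u) (inverse a)) (cong₂ _+_ maxW-inverse-a (maxW-inverse u-perm))
      shifted-inverse-u : shift (j + r) (inverse u) ≡ low
      shifted-inverse-u = trans (cong (shift (j + r)) (inverse-interval u)) (sym (map-∘ (interval 1 k)))
      split-inverse-a : inverse a ≡ map Q (interval 1 j) ++ map Q (interval (suc j) r)
      split-inverse-a = begin
          inverse a                              ≡⟨ inverse-interval a ⟩
          map Q (interval 1 (length a))          ≡⟨ cong (λ n → map Q (interval 1 n)) |a|≡j+r ⟩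
          map Q (interval 1 (j + r))             ≡⟨ cong (map Q) (interval-++ 1 j r) ⟩
          map Q (interval 1 j ++ interval (suc j) r) ≡⟨ map-++ Q (interval 1 j) _ ⟩
          map Q (interval 1 j) ++ map Q (interval (suc j) r) ∎

  inverse-ψ∘-⊙ : inverse (ψ ∘ (suc j + maxW u) (a ⊙ u)) ≡ φ (shiftMask (length u) (mask j r)) (inverse u ⊙ inverse a)
  inverse-ψ∘-⊙ = trans (cong inverse ψ∘-⊙≡S) (trans inverse-S≡blocks (sym φ≡blocks))

ψ∘-⊙-permutation : ∀ {a u} j → IsPermutation a → IsPermutation u → j ≤ maxW a → IsPermutation (ψ ∘ (suc j + maxW u) (a ⊙ u))
ψ∘-⊙-permutation {a} {u} j a-perm u-perm j≤maxW = ψ∘-permutation (⊙-permutation a-perm u-perm) (s≤s z≤n) (begin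
    suc j + maxW u       ≡⟨ +-comm (suc j) (maxW u) ⟩
    maxW u + suc j       ≤⟨ +-monoʳ-≤ (maxW u) (s≤s j≤maxW) ⟩
    maxW u + suc (maxW a) ≡⟨ +-suc (maxW u) (maxW a) ⟩
    suc (maxW u + maxW a) ≡⟨ cong suc (sym (maxW-⊙ a u)) ⟩
    suc (maxW (a ⊙ u))   ∎)
  where open ≤-Reasoning

-- w = u ◁_R φ_{{j + 1}} v′ and σ = u ◁_B ψ_{(j + 1)∘} v′, with v′ a permutation of length j + r.
PermRedProd : Word → Word → Set
PermRedProd u w = Σ ℕ λ j → Σ ℕ λ r → Σ Word λ v′ →
  IsPermutation v′ × length v′ ≡ j + r × w ≡ φ (shiftMask (length u) (mask j r)) (u ⊙ v′)

PermBlueProd : Word → Word → Set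
PermBlueProd u σ = Σ ℕ λ j → Σ ℕ λ r → Σ Word λ v′ →
  IsPermutation v′ × length v′ ≡ j + r × σ ≡ ψ ∘ (suc j + maxW u) (v′ ⊙ u)

redProd⇒PermRedProd : ∀ {u v w} → IsPermutation w → Packed u → RedProd u v w → IsPermutation u × PermRedProd u w
redProd⇒PermRedProd {u} {w = w} (_ , w-unique) u-packed (I , v′ , v′-packed , (1≤count , |I|≡) , _ , w≡) =
  (u-packed , Unique.map⁻ (Unique-++⁻ˡ (shift M u) split-unique)) ,
  j , r , v′ , (v′-packed , v′-unique) , |v′|≡j+r , subst (λ I → w ≡ φ (shiftMask (length u) I) (u ⊙ v′)) I≡mask w≡
  where
  M = maxW v′
  N = suc (maxW (u ⊙ v′))
  split-unique : Unique (shift M u ++ phiAux N I v′)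
  split-unique = subst Unique (trans w≡ (phiAux-++ N I (shift M u) v′ (length-map _ u))) w-unique
  φ-unique : Unique (phiAux N I v′)
  φ-unique = Unique-++⁻ʳ (shift M u) split-unique
  count≡1 : countTrue I ≡ 1
  count≡1 = ≤-antisym (Unique-phiAux⇒countTrue≤1 N I v′ φ-unique) 1≤count
  j = proj₁ (countTrue≡1⇒mask I count≡1)
  r = proj₁ (proj₂ (countTrue≡1⇒mask I count≡1))
  I≡mask : I ≡ mask j r
  I≡mask = proj₂ (proj₂ (countTrue≡1⇒mask I count≡1))
  v′-unique : Unique v′
  v′-unique = subst Unique (take++drop≡id j v′)
    (Unique-delete (take j v′) (subst Unique (trans (cong (λ I → phiAux N I v′) I≡mask) (phiAux-mask N j r v′)) φ-unique))
  |v′|≡j+r : length v′ ≡ j + r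
  |v′|≡j+r = +-cancelʳ-≡ 1 (length v′) (j + r) (begin
      length v′ + 1              ≡⟨ cong (length v′ +_) (sym count≡1) ⟩
      length v′ + countTrue I    ≡⟨ sym |I|≡ ⟩
      length I                   ≡⟨ cong length I≡mask ⟩
      length (mask j r)          ≡⟨ length-mask j r ⟩
      j + suc r                  ≡⟨ +-suc j r ⟩
      suc (j + r)                ≡⟨ +-comm 1 (j + r) ⟩
      j + r + 1                  ∎)
    where open ≡-Reasoning

blueProd⇒PermBlueProd : ∀ {u v σ} → IsPermutation σ → Packed u → BlueProd u v σ → IsPermutation u × PermBlueProd u σ
blueProd⇒PermBlueProd {u} (_ , σ-unique) _ (• , i , v′ , (_ , v′-covered) , (1≤i , i≤maxW) , _ , σ≡) =
  ⊥-elim (Unique-++⇒disjoint (v′ ⊙ u) (subst Unique σ≡ σ-unique) repeated (here refl))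
  where
  repeated : i + maxW u ∈ v′ ⊙ u
  repeated = ∈-++⁺ˡ (subst (_∈ shift (maxW u) v′) (+-comm (maxW u) i) (∈-map⁺ (maxW u +_) (v′-covered i 1≤i i≤maxW)))
blueProd⇒PermBlueProd {u} (_ , σ-unique) u-packed (∘ , suc j , v′ , v′-packed , (_ , j<1+maxW) , _ , σ≡) =
  (u-packed , Unique-++⁻ʳ (shift K v′) ⊙-unique) , j , length v′ ∸ j , v′ , v′-perm , sym (m+[n∸m]≡n j≤|v′|) , σ≡
  where
  K = maxW u
  ⊙-unique : Unique (v′ ⊙ u)
  ⊙-unique = Unique.map⁻ (Unique-++⁻ˡ (map (bump (suc j + K)) (v′ ⊙ u)) (subst Unique σ≡ σ-unique))
  v′-perm : IsPermutation v′
  v′-perm = v′-packed , Unique.map⁻ (Unique-++⁻ˡ (shift K v′) ⊙-unique)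
  j≤|v′| : j ≤ length v′
  j≤|v′| = ≤-trans (≤-pred j<1+maxW) (≤-reflexive (permutation-maxW≡length v′-perm))

inverse-PermBlueProd : ∀ {u σ} → IsPermutation u → PermBlueProd u σ → PermRedProd (inverse u) (inverse σ)
inverse-PermBlueProd {u} u-perm (j , r , v′ , v′-perm , |v′|≡j+r , refl) =
  j , r , inverse v′ , inverse-permutation v′-perm , trans (length-inverse v′) |v′|≡j+r ,
  trans (inverse-ψ∘-⊙ j r u-perm v′-perm |v′|≡j+r)
        (cong (λ n → φ (shiftMask n (mask j r)) (inverse u ⊙ inverse v′)) (sym (length-inverse u)))

inverse-PermRedProd : ∀ {u w} → IsPermutation u → PermRedProd u w → PermBlueProd (inverse u) (inverse w)
inverse-PermRedProd {u} u-perm (j , r , v′ , v′-perm , |v′|≡j+r , refl) =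
  j , r , inverse v′ , inverse-permutation v′-perm , trans (length-inverse v′) |v′|≡j+r , (begin
    inverse (φ (shiftMask (length u) (mask j r)) (u ⊙ v′))
      ≡⟨ cong inverse (sym inverse-blue) ⟩
    inverse (inverse blue)
      ≡⟨ inverse-involutive (ψ∘-⊙-permutation j (inverse-permutation v′-perm) (inverse-permutation u-perm) j≤maxW) ⟩
    blue ∎)
  where
  open ≡-Reasoning
  blue = ψ ∘ (suc j + maxW (inverse u)) (inverse v′ ⊙ inverse u)
  j≤maxW : j ≤ maxW (inverse v′)
  j≤maxW = ≤-trans (m≤m+n j r) (≤-reflexive (sym (trans (maxW-inverse v′-perm) |v′|≡j+r)))
  inverse-blue : inverse blue ≡ φ (shiftMask (length u) (mask j r)) (u ⊙ v′)
  inverse-blue = trans (inverse-ψ∘-⊙ j r (inverse-permutation u-perm) (inverse-permutation v′-perm)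
                                     (trans (length-inverse v′) |v′|≡j+r))
    (cong₂ (λ n w → φ (shiftMask n (mask j r)) w) (length-inverse u)
           (cong₂ _⊙_ (inverse-involutive u-perm) (inverse-involutive v′-perm)))

PermRedProd⇒redProd : ∀ {u w} → PermRedProd u w → ∃ λ v → Packed v × v ≢ [] × RedProd u v w
PermRedProd⇒redProd (j , r , v′ , (v′-packed , _) , |v′|≡j+r , w≡) =
  φ (mask j r) v′ , φ-mask-packed , φ-mask≢[] ,
  mask j r , v′ , v′-packed , (1≤count , |mask|≡) , refl , w≡
  where
  N = suc (maxW v′)
  φ-mask≡ : φ (mask j r) v′ ≡ take j v′ ++ suc (maxW (take j v′ ++ drop j v′)) ∷ drop j v′
  φ-mask≡ = trans (phiAux-mask N j r v′) (cong (λ ws → take j v′ ++ suc (maxW ws) ∷ drop j v′) (sym (take++drop≡id j v′)))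
  φ-mask-packed : Packed (φ (mask j r) v′)
  φ-mask-packed = subst Packed (sym φ-mask≡)
    (Packed-insert-max (take j v′) (drop j v′) (subst Packed (sym (take++drop≡id j v′)) v′-packed))
  φ-mask≢[] : φ (mask j r) v′ ≢ []
  φ-mask≢[] eq with ++-conicalʳ (take j v′) _ (trans (sym (phiAux-mask N j r v′)) eq)
  ... | ()
  1≤count : 1 ≤ countTrue (mask j r)
  1≤count = ≤-reflexive (sym (countTrue-mask j r))
  |mask|≡ : length (mask j r) ≡ length v′ + countTrue (mask j r)
  |mask|≡ = begin
      length (mask j r)           ≡⟨ length-mask j r ⟩
      j + suc r                   ≡⟨ +-suc j r ⟩
      suc (j + r)                 ≡⟨ +-comm 1 (j + r) ⟩
      j + r + 1                   ≡⟨ cong₂ _+_ (sym |v′|≡j+r) (sym (countTrue-mask j r)) ⟩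
      length v′ + countTrue (mask j r) ∎
    where open ≡-Reasoning

PermBlueProd⇒blueProd : ∀ {u σ} → PermBlueProd u σ → ∃ λ v → Packed v × v ≢ [] × BlueProd u v σ
PermBlueProd⇒blueProd (j , r , v′ , v′-perm , |v′|≡j+r , σ≡) =
  ψ ∘ (suc j) v′ , proj₁ (ψ∘-permutation v′-perm (s≤s z≤n) (s≤s j≤maxW)) , ψ∘≢[] ,
  ∘ , suc j , v′ , proj₁ v′-perm , (s≤s z≤n , s≤s j≤maxW) , refl , σ≡
  where
  j≤maxW : j ≤ maxW v′
  j≤maxW = ≤-trans (m≤m+n j r) (≤-reflexive (sym (trans (permutation-maxW≡length v′-perm) |v′|≡j+r)))
  ψ∘≢[] : ψ ∘ (suc j) v′ ≢ []
  ψ∘≢[] eq with ++-conicalʳ (map (bump (suc j)) v′) _ eq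
  ... | ()

mainTheorem11 : (σ : Word) → IsPermutation σ →
    BlueIrreducible σ ⇔ RedIrreducible (inverse σ)
mainTheorem11 σ σ-perm = mk⇔
  (λ (irreducible , blue-irreducible) → irreducible-inverse σ-perm irreducible ,
    λ u v u-packed _ _ red →
      let (u-perm , red′) = redProd⇒PermRedProd τ-perm u-packed red
          (v″ , v″-packed , v″≢[] , blue) = PermBlueProd⇒blueProd
            (subst (PermBlueProd (inverse u)) (inverse-involutive σ-perm) (inverse-PermRedProd {u} u-perm red′))
      in inverse-≡[] (blue-irreducible (inverse u) v″ (proj₁ (inverse-permutation u-perm)) v″-packed v″≢[] blue))
  (λ (irreducible , red-irreducible) →
    subst Irreducible (inverse-involutive σ-perm) (irreducible-inverse τ-perm irreducible) ,
    λ u v u-packed _ _ blue →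
      let (u-perm , blue′) = blueProd⇒PermBlueProd σ-perm u-packed blue
          (v″ , v″-packed , v″≢[] , red) = PermRedProd⇒redProd {inverse u} (inverse-PermBlueProd {u} u-perm blue′)
      in inverse-≡[] (red-irreducible (inverse u) v″ (proj₁ (inverse-permutation u-perm)) v″-packed v″≢[] red))
  where
  τ-perm = inverse-permutation σ-perm
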